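{- In a dagger kernel category, the relation $\le$ on morphisms $X\to Y$ is a partial order on each homset, and the zero morphism is its least element.
   Context: A dagger category is a category with a contravariant functor $\dagger$ that is the identity on objects with $f^{\dagger\dagger}=f$; $f$ is a dagger mono if $f^\dagger\circ f=\mathrm{id}$. A dagger kernel category is a dagger category with a zero object $0$ in which every morphism $f$ has a kernel (universal $k$ with $f\circ k=0$) that can be chosen to be a dagger mono, denoted $\ker(f)$; $\mathrm{coker}(f)=\ker(f^\dagger)^\dagger$. For $f\colon X\to Y$ let $i_f=\ker(\mathrm{coker}(f))\colon\mathrm{Im}(f)\to Y$ (a dagger mono) and $e_f=(i_f)^\dagger\circ f$, so $f=i_f\circ e_f$; similarly $f^\dagger=i_{f^\dagger}\circ e_{f^\dagger}$. Let $m_f\colon\mathrm{Im}(f^\dagger)\to\mathrm{Im}(f)$ be the unique morphism with $m_f\circ(i_{f^\dagger})^\dagger=e_f$ and $i_f\circ m_f=(e_{f^\dagger})^\dagger$, so that $f=i_f\circ m_f\circ(i_{f^\dagger})^\dagger$. For parallel $f,g\colon X\to Y$ define $f\le g$ iff there exist $\varphi\colon\mathrm{Im}(f)\to\mathrm{Im}(g)$ and $\psi\colon\mathrm{Im}(f^\dagger)\to\mathrm{Im}(g^\dagger)$ with $\psi^\dagger\circ(i_{g^\dagger})^\dagger=(i_{f^\dagger})^\dagger$, $\varphi\circ m_f=m_g\circ\psi$, $\varphi^\dagger\circ m_g=m_f\circ\psi^\dagger$, and $i_g\circ\varphi=i_f$. -}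

module Defs where

open import Level using (Level; _⊔_; suc)
open import Relation.Binary using (Rel; IsEquivalence)
open import Data.Product using (Σ; _×_; _,_)

record Category (o ℓ ℓ′ : Level) : Set (suc (o ⊔ ℓ ⊔ ℓ′)) where
  infixr 9 _∘_
  infix  4 _≈_
  field
    Obj   : Set o
    Hom   : Obj → Obj → Set ℓ
    _≈_   : ∀ {A B} → Rel (Hom A B) ℓ′
    id    : ∀ {A} → Hom A A
    _∘_   : ∀ {A B C} → Hom B C → Hom A B → Hom A C
    ≈-equiv : ∀ {A B} → IsEquivalence (_≈_ {A} {B})
    ∘-resp-≈ : ∀ {A B C} {f h : Hom B C} {g i : Hom A B} →
               f ≈ h → g ≈ i → f ∘ g ≈ h ∘ i
    assoc : ∀ {A B C D} {f : Hom A B} {g : Hom B C} {h : Hom C D} →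
            (h ∘ g) ∘ f ≈ h ∘ (g ∘ f)
    identityˡ : ∀ {A B} {f : Hom A B} → id ∘ f ≈ f
    identityʳ : ∀ {A B} {f : Hom A B} → f ∘ id ≈ f

record DaggerCategory (o ℓ ℓ′ : Level) : Set (suc (o ⊔ ℓ ⊔ ℓ′)) where
  field
    category : Category o ℓ ℓ′
  open Category category public
  infix 10 _†
  field
    _†       : ∀ {A B} → Hom A B → Hom B A
    †-resp-≈ : ∀ {A B} {f g : Hom A B} → f ≈ g → f † ≈ g †
    †-identity : ∀ {A} → (id {A}) † ≈ id
    †-homomorphism : ∀ {A B C} {f : Hom A B} {g : Hom B C} →
                     (g ∘ f) † ≈ f † ∘ g †
    †-involutive : ∀ {A B} {f : Hom A B} → (f †) † ≈ f

  IsDaggerMono : ∀ {A B} → Hom A B → Set ℓ′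
  IsDaggerMono f = f † ∘ f ≈ id

record DaggerKernelCategory (o ℓ ℓ′ : Level) : Set (suc (o ⊔ ℓ ⊔ ℓ′)) where
  field
    daggerCategory : DaggerCategory o ℓ ℓ′
  open DaggerCategory daggerCategory public
  field
    𝟘   : Obj
    ¡   : ∀ {A} → Hom 𝟘 A
    !   : ∀ {A} → Hom A 𝟘
    ¡-unique : ∀ {A} (f : Hom 𝟘 A) → ¡ ≈ f
    !-unique : ∀ {A} (f : Hom A 𝟘) → ! ≈ f

  zeroHom : ∀ {A B} → Hom A B
  zeroHom = ¡ ∘ !

  field
    KerObj : ∀ {A B} → Hom A B → Obj
    ker    : ∀ {A B} (f : Hom A B) → Hom (KerObj f) A
    ker-zero : ∀ {A B} (f : Hom A B) → f ∘ ker f ≈ zeroHom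
    ker-factor : ∀ {A B Z} (f : Hom A B) (k : Hom Z A) →
                 f ∘ k ≈ zeroHom → Hom Z (KerObj f)
    ker-factor-commutes : ∀ {A B Z} (f : Hom A B) (k : Hom Z A)
                          (p : f ∘ k ≈ zeroHom) →
                          ker f ∘ ker-factor f k p ≈ k
    ker-factor-unique : ∀ {A B Z} (f : Hom A B) (k : Hom Z A)
                        (p : f ∘ k ≈ zeroHom) (u : Hom Z (KerObj f)) →
                        ker f ∘ u ≈ k → u ≈ ker-factor f k p
    ker-daggerMono : ∀ {A B} (f : Hom A B) → IsDaggerMono (ker f)

  CokerObj : ∀ {A B} → Hom A B → Obj
  CokerObj f = KerObj (f †)

  coker : ∀ {A B} (f : Hom A B) → Hom B (CokerObj f)
  coker f = (ker (f †)) †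

  Im : ∀ {A B} → Hom A B → Obj
  Im f = KerObj (coker f)

  i : ∀ {A B} (f : Hom A B) → Hom (Im f) B
  i f = ker (coker f)

  e : ∀ {A B} (f : Hom A B) → Hom A (Im f)
  e f = (i f) † ∘ f

  -- The paper defines m_f as the unique morphism
  -- with m_f ∘ (i_{f†})† = e_f and i_f ∘ m_f = (e_{f†})†; that unique
  -- morphism is (i_f)† ∘ f ∘ i_{f†}, which we take as the definition.
  m : ∀ {A B} (f : Hom A B) → Hom (Im (f †)) (Im f)
  m f = (i f) † ∘ (f ∘ i (f †))

  infix 4 _≤_
  _≤_ : ∀ {A B} → Rel (Hom A B) (ℓ ⊔ ℓ′)
  f ≤ g = Σ (Hom (Im f) (Im g)) λ φ → Σ (Hom (Im (f †)) (Im (g †))) λ ψ →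
            ((ψ † ∘ (i (g †)) † ≈ (i (f †)) †)
           × (φ ∘ m f ≈ m g ∘ ψ)
           × (φ † ∘ m g ≈ m f ∘ ψ †)
           × (i g ∘ φ ≈ i f))

module Submission where

-- Everything rests on two facts about the chosen kernels: a morphism x with
-- h ∘ x ≈ 0 is fixed by the projection ker h ∘ (ker h)†, and dually every c
-- with c ∘ f ≈ 0 factors through coker f.  From these we get the image
-- factorisation f ≈ i f ∘ m f ∘ (j f)† (j f = i (f †) is the coimage
-- inclusion) and minimality of images: whatever kills f kills i f.
--
-- For the order we use canonical witnesses φ = (i g)† ∘ i f and
-- ψ = (j g)† ∘ j f: they witness f ≤ g as soon as the image and coimage of f
-- lie in those of g and g agrees with f on the relevant compressions.  This
-- gives reflexivity (f ≈ g) and leastness of zero at once.  Transitivity is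
-- pasting of the defining squares and triangles; antisymmetry follows from
-- the factorisation, because the coimage witnesses ψ, ψ' of f ≤ g and g ≤ f
-- relate two dagger monos factoring through each other, forcing ψ ≈ ψ' †.

open import Defs
open import Level using (Level)
open import Data.Product using (_×_; _,_)
open import Relation.Binary.Structures using (IsPartialOrder; IsEquivalence)
open import Relation.Binary.Bundles using (Setoid)
import Relation.Binary.Reasoning.Setoid as SetoidReasoning

module Order {o ℓ ℓ′ : Level} (C : DaggerKernelCategory o ℓ ℓ′) where
  open DaggerKernelCategory C

  module _ {A B : Obj} where
    open IsEquivalence (≈-equiv {A} {B}) public
      using () renaming (refl to ≈-refl; sym to ≈-sym; trans to ≈-trans)

  homSetoid : Obj → Obj → Setoid ℓ ℓ′
  homSetoid A B = record { Carrier = Hom A B ; _≈_ = _≈_ ; isEquivalence = ≈-equiv }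

  module HomReasoning {A B : Obj} = SetoidReasoning (homSetoid A B)
  open HomReasoning

  infixr 9 _⟩∘_ _∘⟨_
  _⟩∘_ : ∀ {A B D} {f h : Hom B D} → f ≈ h → (g : Hom A B) → f ∘ g ≈ h ∘ g
  p ⟩∘ g = ∘-resp-≈ p ≈-refl

  _∘⟨_ : ∀ {A B D} (f : Hom B D) {g h : Hom A B} → g ≈ h → f ∘ g ≈ f ∘ h
  f ∘⟨ p = ∘-resp-≈ ≈-refl p

  assoc⁻¹ : ∀ {A B D E} {f : Hom A B} {g : Hom B D} {h : Hom D E} →
            h ∘ (g ∘ f) ≈ (h ∘ g) ∘ f
  assoc⁻¹ = ≈-sym assoc

  triangle : ∀ {A B D E} {p : Hom D E} {q : Hom B D} {r : Hom B E}
               {s : Hom A B} {t : Hom A E} →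
             p ∘ q ≈ r → r ∘ s ≈ t → p ∘ (q ∘ s) ≈ t
  triangle pq rs = ≈-trans assoc⁻¹ (≈-trans (pq ⟩∘ _) rs)

  square : ∀ {A B D E F G} {a : Hom A B} {x : Hom B E} {y : Hom D E}
             {b : Hom A D} {c : Hom E G} {z : Hom F G} {d : Hom D F} →
           x ∘ a ≈ y ∘ b → c ∘ y ≈ z ∘ d → c ∘ (x ∘ a) ≈ z ∘ (d ∘ b)
  square {a = a} {x} {y} {b} {c} {z} {d} xa cy = begin
    c ∘ (x ∘ a)   ≈⟨ c ∘⟨ xa ⟩
    c ∘ (y ∘ b)   ≈⟨ assoc⁻¹ ⟩
    (c ∘ y) ∘ b   ≈⟨ cy ⟩∘ b ⟩
    (z ∘ d) ∘ b   ≈⟨ assoc ⟩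
    z ∘ (d ∘ b)   ∎

  zero-left : ∀ {A B D} (f : Hom A B) → zeroHom {B} {D} ∘ f ≈ zeroHom
  zero-left f = ≈-trans assoc (¡ ∘⟨ ≈-sym (!-unique _))

  zero-right : ∀ {A B D} (f : Hom B D) → f ∘ zeroHom {A} {B} ≈ zeroHom
  zero-right f = ≈-trans assoc⁻¹ (≈-sym (¡-unique _) ⟩∘ !)

  zero-† : ∀ {A B} → zeroHom {A} {B} † ≈ zeroHom
  zero-† = ≈-trans †-homomorphism (∘-resp-≈ (≈-sym (¡-unique _)) (≈-sym (!-unique _)))

  †-injective : ∀ {A B} {f g : Hom A B} → f † ≈ g † → f ≈ g
  †-injective {f = f} {g} p = begin
    f       ≈⟨ ≈-sym †-involutive ⟩
    f † †   ≈⟨ †-resp-≈ p ⟩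
    g † †   ≈⟨ †-involutive ⟩
    g       ∎

  †-transpose : ∀ {A B D} (a : Hom A B) (b : Hom D B) → (a † ∘ b) † ≈ b † ∘ a
  †-transpose a b = ≈-trans †-homomorphism (_ ∘⟨ †-involutive)

  †-commutes : ∀ {A B D} {a : Hom A B} {b : Hom B D} {c : Hom A D} →
               a † ∘ b † ≈ c † → b ∘ a ≈ c
  †-commutes p = †-injective (≈-trans †-homomorphism p)

  ker-projection : ∀ {A B Z} (h : Hom A B) (x : Hom Z A) → h ∘ x ≈ zeroHom →
                   ker h ∘ ((ker h) † ∘ x) ≈ x
  ker-projection h x p = begin
    ker h ∘ ((ker h) † ∘ x)         ≈⟨ ker h ∘⟨ (ker h) † ∘⟨ ≈-sym factors ⟩
    ker h ∘ ((ker h) † ∘ (ker h ∘ u)) ≈⟨ ker h ∘⟨ assoc⁻¹ ⟩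
    ker h ∘ (((ker h) † ∘ ker h) ∘ u) ≈⟨ ker h ∘⟨ (ker-daggerMono h ⟩∘ u) ⟩
    ker h ∘ (id ∘ u)                ≈⟨ ker h ∘⟨ identityˡ ⟩
    ker h ∘ u                       ≈⟨ factors ⟩
    x                               ∎
    where
    u = ker-factor h x p
    factors : ker h ∘ u ≈ x
    factors = ker-factor-commutes h x p

  coker-projection : ∀ {A B Z} (f : Hom A B) (c : Hom B Z) → c ∘ f ≈ zeroHom →
                     (c ∘ ker (f †)) ∘ coker f ≈ c
  coker-projection f c p = †-commutes (begin
    coker f † ∘ (c ∘ k) †   ≈⟨ ∘-resp-≈ †-involutive †-homomorphism ⟩
    k ∘ (k † ∘ c †)         ≈⟨ ker-projection (f †) (c †) f†c†≈0 ⟩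
    c †                     ∎)
    where
    k = ker (f †)
    f†c†≈0 : f † ∘ c † ≈ zeroHom
    f†c†≈0 = ≈-trans (≈-sym †-homomorphism) (≈-trans (†-resp-≈ p) zero-†)

  coker-annihilates : ∀ {A B} (f : Hom A B) → coker f ∘ f ≈ zeroHom
  coker-annihilates f = †-commutes (begin
    f † ∘ coker f †     ≈⟨ f † ∘⟨ †-involutive ⟩
    f † ∘ ker (f †)     ≈⟨ ker-zero (f †) ⟩
    zeroHom             ≈⟨ ≈-sym zero-† ⟩
    zeroHom †           ∎)

  annihilates-image : ∀ {A B Z} (f : Hom A B) (c : Hom B Z) →
                      c ∘ f ≈ zeroHom → c ∘ i f ≈ zeroHom
  annihilates-image f c p = begin
    c ∘ i f                                 ≈⟨ ≈-sym (coker-projection f c p) ⟩∘ i f ⟩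
    ((c ∘ ker (f †)) ∘ coker f) ∘ i f       ≈⟨ assoc ⟩
    (c ∘ ker (f †)) ∘ (coker f ∘ i f)       ≈⟨ _ ∘⟨ ker-zero (coker f) ⟩
    (c ∘ ker (f †)) ∘ zeroHom               ≈⟨ zero-right _ ⟩
    zeroHom                                 ∎

  image-of-zero : ∀ {A B} (h : Hom A B) → h ≈ zeroHom → i h ≈ zeroHom
  image-of-zero h h≈0 =
    ≈-trans (≈-sym identityˡ) (annihilates-image h id (≈-trans identityˡ h≈0))

  image-retract : ∀ {A B} (f : Hom A B) → i f ∘ ((i f) † ∘ f) ≈ f
  image-retract f = ker-projection (coker f) f (coker-annihilates f)

  image-factor : ∀ {A B Z} (f : Hom A B) (x : Hom Z A) →
                 i f ∘ ((i f) † ∘ (f ∘ x)) ≈ f ∘ x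
  image-factor f x = begin
    i f ∘ ((i f) † ∘ (f ∘ x))   ≈⟨ i f ∘⟨ assoc⁻¹ ⟩
    i f ∘ (((i f) † ∘ f) ∘ x)   ≈⟨ assoc⁻¹ ⟩
    (i f ∘ ((i f) † ∘ f)) ∘ x   ≈⟨ image-retract f ⟩∘ x ⟩
    f ∘ x                       ∎

  image-inclusion : ∀ {A B} (f g : Hom A B) → coker g ∘ f ≈ zeroHom →
                    i g ∘ ((i g) † ∘ i f) ≈ i f
  image-inclusion f g p = ker-projection (coker g) (i f) (annihilates-image f (coker g) p)

  j : ∀ {A B} (f : Hom A B) → Hom (Im (f †)) A
  j f = i (f †)

  coimage-retract : ∀ {A B} (f : Hom A B) → f ∘ (j f ∘ (j f) †) ≈ f
  coimage-retract f = †-commutes (begin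
    (j f ∘ (j f) †) † ∘ f †       ≈⟨ †-homomorphism ⟩∘ f † ⟩
    ((j f) † † ∘ (j f) †) ∘ f †   ≈⟨ (†-involutive ⟩∘ (j f) †) ⟩∘ f † ⟩
    (j f ∘ (j f) †) ∘ f †         ≈⟨ assoc ⟩
    j f ∘ ((j f) † ∘ f †)         ≈⟨ image-retract (f †) ⟩
    f †                           ∎)

  coimage-factor : ∀ {A B Z} (f : Hom A B) (x : Hom Z A) →
                   (f ∘ j f) ∘ ((j f) † ∘ x) ≈ f ∘ x
  coimage-factor f x = begin
    (f ∘ j f) ∘ ((j f) † ∘ x)   ≈⟨ assoc⁻¹ ⟩
    ((f ∘ j f) ∘ (j f) †) ∘ x   ≈⟨ assoc ⟩∘ x ⟩
    (f ∘ (j f ∘ (j f) †)) ∘ x   ≈⟨ coimage-retract f ⟩∘ x ⟩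
    f ∘ x                       ∎

  factorisation : ∀ {A B} (f : Hom A B) → i f ∘ (m f ∘ (j f) †) ≈ f
  factorisation f = begin
    i f ∘ (((i f) † ∘ (f ∘ j f)) ∘ (j f) †)   ≈⟨ i f ∘⟨ assoc ⟩
    i f ∘ ((i f) † ∘ ((f ∘ j f) ∘ (j f) †))   ≈⟨ i f ∘⟨ (i f) † ∘⟨ ≈-trans assoc (coimage-retract f) ⟩
    i f ∘ ((i f) † ∘ f)                       ≈⟨ image-retract f ⟩
    f                                         ∎

  comparison-intertwines : ∀ {A B} (f g : Hom A B) →
    (i g) † ∘ (f ∘ j f) ≈ (i g) † ∘ (g ∘ j f) →
    ((i g) † ∘ i f) ∘ m f ≈ m g ∘ ((j g) † ∘ j f)
  comparison-intertwines f g agree = begin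
    ((i g) † ∘ i f) ∘ ((i f) † ∘ (f ∘ j f))   ≈⟨ assoc ⟩
    (i g) † ∘ (i f ∘ ((i f) † ∘ (f ∘ j f)))   ≈⟨ _ ∘⟨ image-factor f (j f) ⟩
    (i g) † ∘ (f ∘ j f)                       ≈⟨ agree ⟩
    (i g) † ∘ (g ∘ j f)                       ≈⟨ _ ∘⟨ ≈-sym (coimage-factor g (j f)) ⟩
    (i g) † ∘ ((g ∘ j g) ∘ ((j g) † ∘ j f))   ≈⟨ assoc⁻¹ ⟩
    m g ∘ ((j g) † ∘ j f)                     ∎

  canonical-≤ : ∀ {A B} (f g : Hom A B) →
    coker g ∘ f ≈ zeroHom → coker (g †) ∘ f † ≈ zeroHom →
    (i g) † ∘ (f ∘ j f) ≈ (i g) † ∘ (g ∘ j f) →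
    (i f) † ∘ (g ∘ j g) ≈ (i f) † ∘ (f ∘ j g) →
    f ≤ g
  canonical-≤ f g im co agree-f agree-g =
    (i g) † ∘ i f , (j g) † ∘ j f ,
    ≈-trans (≈-sym †-homomorphism) (†-resp-≈ (image-inclusion (f †) (g †) co)) ,
    comparison-intertwines f g agree-f ,
    ≈-trans (†-transpose (i g) (i f) ⟩∘ m g)
      (≈-trans (comparison-intertwines g f agree-g)
               (m f ∘⟨ ≈-sym (†-transpose (j g) (j f)))) ,
    image-inclusion f g im

  ≤-reflexive : ∀ {A B} {f g : Hom A B} → f ≈ g → f ≤ g
  ≤-reflexive {f = f} {g} f≈g = canonical-≤ f g
    (≈-trans (coker g ∘⟨ f≈g) (coker-annihilates g))
    (≈-trans (coker (g †) ∘⟨ †-resp-≈ f≈g) (coker-annihilates (g †)))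
    (_ ∘⟨ (f≈g ⟩∘ j f))
    (_ ∘⟨ (≈-sym f≈g ⟩∘ j g))

  -- Zero is below everything: both sides of each hypothesis vanish, since
  -- the image and coimage of zero are zero.
  zero-least : ∀ {A B} (f : Hom A B) → zeroHom ≤ f
  zero-least f = canonical-≤ zeroHom f
    (zero-right _)
    (≈-trans (_ ∘⟨ zero-†) (zero-right _))
    (both-zero (≈-trans (_ ∘⟨ zero-left _) (zero-right _))
               (≈-trans (_ ∘⟨ (f ∘⟨ j0≈0)) (≈-trans (_ ∘⟨ zero-right f) (zero-right _))))
    (both-zero (≈-trans (i0†≈0 ⟩∘ _) (zero-left _))
               (≈-trans (i0†≈0 ⟩∘ _) (zero-left _)))
    where
    both-zero : ∀ {X Y} {x y : Hom X Y} → x ≈ zeroHom → y ≈ zeroHom → x ≈ y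
    both-zero x≈0 y≈0 = ≈-trans x≈0 (≈-sym y≈0)
    j0≈0 : j (zeroHom {_} {_}) ≈ zeroHom
    j0≈0 = image-of-zero (zeroHom †) zero-†
    i0†≈0 : (i (zeroHom {_} {_})) † ≈ zeroHom
    i0†≈0 = ≈-trans (†-resp-≈ (image-of-zero zeroHom ≈-refl)) zero-†

  ≤-trans : ∀ {A B} {f g h : Hom A B} → f ≤ g → g ≤ h → f ≤ h
  ≤-trans (φ , ψ , ψ-dom , φψ , φψ† , φ-im) (φ' , ψ' , ψ'-dom , φ'ψ' , φ'ψ'† , φ'-im) =
    φ' ∘ φ , ψ' ∘ ψ ,
    ≈-trans (†-homomorphism ⟩∘ _) (≈-trans assoc (≈-trans (_ ∘⟨ ψ'-dom) ψ-dom)) ,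
    ≈-trans assoc (square φψ φ'ψ') ,
    ≈-trans (†-homomorphism ⟩∘ _)
      (≈-trans assoc (≈-trans (square φ'ψ'† φψ†) (_ ∘⟨ ≈-sym †-homomorphism))) ,
    triangle φ'-im φ-im

  mutual-factors-adjoint : ∀ {P Q X} {a : Hom P X} {b : Hom Q X}
                             {u : Hom P Q} {v : Hom Q P} →
                           IsDaggerMono b → IsDaggerMono a →
                           b ∘ u ≈ a → a ∘ v ≈ b → u ≈ v †
  mutual-factors-adjoint {a = a} {b} {u} {v} b-mono a-mono bu≈a av≈b = begin
    u               ≈⟨ ≈-sym identityˡ ⟩
    id ∘ u          ≈⟨ ≈-sym b-mono ⟩∘ u ⟩
    (b † ∘ b) ∘ u   ≈⟨ ≈-trans assoc (b † ∘⟨ bu≈a) ⟩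
    b † ∘ a         ≈⟨ ≈-sym (†-transpose a b) ⟩
    (a † ∘ b) †     ≈⟨ †-resp-≈ (a † ∘⟨ ≈-sym av≈b) ⟩
    (a † ∘ (a ∘ v)) † ≈⟨ †-resp-≈ (triangle a-mono identityˡ) ⟩
    v †             ∎

  -- Antisymmetry: f ≈ i g ∘ m g ∘ ψ ∘ (j f)† by the factorisation of f, and
  -- the coimage witnesses of f ≤ g and g ≤ f are adjoint, so ψ ∘ (j f)† ≈ (j g)†.
  ≤-antisym : ∀ {A B} {f g : Hom A B} → f ≤ g → g ≤ f → f ≈ g
  ≤-antisym {f = f} {g} (φ , ψ , ψ-dom , φψ , _ , φ-im) (_ , ψ' , ψ'-dom , _ , _ , _) = begin
    f                              ≈⟨ ≈-sym (factorisation f) ⟩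
    i f ∘ (m f ∘ (j f) †)          ≈⟨ ≈-sym φ-im ⟩∘ _ ⟩
    (i g ∘ φ) ∘ (m f ∘ (j f) †)    ≈⟨ ≈-trans assoc (i g ∘⟨ assoc⁻¹) ⟩
    i g ∘ ((φ ∘ m f) ∘ (j f) †)    ≈⟨ i g ∘⟨ (φψ ⟩∘ _) ⟩
    i g ∘ ((m g ∘ ψ) ∘ (j f) †)    ≈⟨ i g ∘⟨ ≈-trans assoc (m g ∘⟨ ψj†) ⟩
    i g ∘ (m g ∘ (j g) †)          ≈⟨ factorisation g ⟩
    g                              ∎
    where
    ψ≈ψ'† : ψ ≈ ψ' †
    ψ≈ψ'† = mutual-factors-adjoint (ker-daggerMono (coker (g †)))
              (ker-daggerMono (coker (f †))) (†-commutes ψ-dom) (†-commutes ψ'-dom)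
    ψj† : ψ ∘ (j f) † ≈ (j g) †
    ψj† = ≈-trans (ψ≈ψ'† ⟩∘ _) ψ'-dom

  ≤-isPartialOrder : ∀ {A B} → IsPartialOrder (_≈_ {A} {B}) (_≤_ {A} {B})
  ≤-isPartialOrder = record
    { isPreorder = record
      { isEquivalence = ≈-equiv
      ; reflexive     = ≤-reflexive
      ; trans         = ≤-trans
      }
    ; antisym = ≤-antisym
    }

lemma7p2 : ∀ {o ℓ e : Level} (C : DaggerKernelCategory o ℓ e) →
           let open DaggerKernelCategory C in
           (∀ {X Y : Obj} → IsPartialOrder (_≈_ {X} {Y}) (_≤_ {X} {Y}))
           × (∀ {X Y : Obj} (f : Hom X Y) → zeroHom ≤ f)
lemma7p2 C = ≤-isPartialOrder , zero-least
  where open Order C
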